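{- In an AL-monoid $A$, for all $a,b,c\in A$: $(a,b,c)M$ holds if and only if $(a\wedge c,\,b,\,a\vee c)M$ holds.
   Context: An AL-monoid (autometrized lattice ordered monoid) is an algebra $(A,+,\vee,\wedge,\ast,0)$ of type $(2,2,2,2,0)$ such that: (1) $(A,+,\vee,\wedge,0)$ is a commutative lattice ordered monoid, i.e. $(A,+,0)$ is a commutative monoid with identity $0$, $(A,\vee,\wedge)$ is a lattice with induced order $\leq$, and $a+(b\vee c)=(a+b)\vee(a+c)$, $a+(b\wedge c)=(a+b)\wedge(a+c)$; (2) $a\ast(a\wedge b)+b=a\vee b$ for all $a,b$; (3) for each $a\in A$ the maps $x\mapsto a+x$, $x\mapsto a\vee x$, $x\mapsto a\wedge x$, $x\mapsto a\ast x$ are contractions with respect to $\ast$, i.e. $f(x)\ast f(y)\leq x\ast y$ for all $x,y$; (4) $[a\ast(a\vee b)]\wedge[b\ast(a\vee b)]=0$ for all $a,b$; and $\ast$ is a metric operation: $a\ast b\geq 0$ with equality iff $a=b$, $a\ast b=b\ast a$, and $a\ast b\leq a\ast c+c\ast b$ for all $a,b,c$. Metric betweenness: $(x,y,z)M$ means $x\ast y+y\ast z=x\ast z$. -}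

module Defs where

open import Level using (Level; suc; _⊔_)
open import Relation.Binary.PropositionalEquality using (_≡_)
open import Data.Product using (_×_)
open import Function.Bundles using (_⇔_)

-- An AL-monoid (autometrized lattice ordered monoid), with propositional
-- equality on the carrier.  The lattice order is  a ≤ b  :⇔  a ∨ b ≡ b.
record ALMonoid (c : Level) : Set (suc c) where
  infixl 6 _+_
  infixr 5 _∨_
  infixr 6 _∧_
  infix 7 _*_
  infix 4 _≤_
  field
    Carrier : Set c
    _+_ _∨_ _∧_ _*_ : Carrier → Carrier → Carrier
    0# : Carrier

  _≤_ : Carrier → Carrier → Set c
  a ≤ b = a ∨ b ≡ b

  field
    +-assoc    : ∀ a b c → (a + b) + c ≡ a + (b + c)
    +-comm     : ∀ a b → a + b ≡ b + a
    +-identityˡ : ∀ a → 0# + a ≡ a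
    ∨-assoc : ∀ a b c → (a ∨ b) ∨ c ≡ a ∨ (b ∨ c)
    ∨-comm  : ∀ a b → a ∨ b ≡ b ∨ a
    ∧-assoc : ∀ a b c → (a ∧ b) ∧ c ≡ a ∧ (b ∧ c)
    ∧-comm  : ∀ a b → a ∧ b ≡ b ∧ a
    ∨-absorbs-∧ : ∀ a b → a ∨ (a ∧ b) ≡ a
    ∧-absorbs-∨ : ∀ a b → a ∧ (a ∨ b) ≡ a
    +-distrib-∨ : ∀ a b c → a + (b ∨ c) ≡ (a + b) ∨ (a + c)
    +-distrib-∧ : ∀ a b c → a + (b ∧ c) ≡ (a + b) ∧ (a + c)
    *-nonneg : ∀ a b → 0# ≤ a * b
    *-zero⇔≡ : ∀ a b → (a * b ≡ 0# ⇔ a ≡ b)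
    *-comm   : ∀ a b → a * b ≡ b * a
    *-triangle : ∀ a b c → a * b ≤ (a * c) + (c * b)
    ax2 : ∀ a b → a * (a ∧ b) + b ≡ a ∨ b
    +-contr : ∀ a x y → (a + x) * (a + y) ≤ x * y
    ∨-contr : ∀ a x y → (a ∨ x) * (a ∨ y) ≤ x * y
    ∧-contr : ∀ a x y → (a ∧ x) * (a ∧ y) ≤ x * y
    *-contr : ∀ a x y → (a * x) * (a * y) ≤ x * y
    ax4 : ∀ a b → (a * (a ∨ b)) ∧ (b * (a ∨ b)) ≡ 0#

  Between : Carrier → Carrier → Carrier → Set c
  Between x y z = x * y + y * z ≡ x * z

-- Write a ⊝ b for a ∗ (a ∧ b); it behaves like the truncated difference
-- (a − b)⁺: it is the least z ≥ 0 with a ≤ b + z.  By axiom (4) the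
-- positive parts a ⊝ b and b ⊝ a have meet 0, so a ∗ b = a ⊝ b + b ⊝ a.
-- Like ∸ on ℕ, ⊝ distributes over ∨ and ∧ (swapping them in its second
-- argument), and x + y = (x ∨ y) + (x ∧ y).  Splitting a ∗ b + b ∗ c into
-- positive parts and regrouping them by these laws gives
-- (a ∧ c) ∗ b + b ∗ (a ∨ c), and the same computation shows
-- a ∗ c = (a ∧ c) ∗ (a ∨ c).  So both betweenness equations have the same
-- two sides.
module Submission where

open import Defs
open import Level using (Level)
open import Data.Product using (_,_)
open import Function.Bundles using (_⇔_; mk⇔; Equivalence)
open import Relation.Binary.PropositionalEquality
open import Relation.Binary.Structures using (IsPartialOrder)
open import Relation.Binary.Bundles using (Poset)
import Relation.Binary.Lattice as Order
import Relation.Binary.Lattice.Properties.MeetSemilattice as MeetSemilatticeProperties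
import Relation.Binary.Reasoning.PartialOrder as PosetReasoning
open import Algebra.Bundles using (CommutativeSemigroup)
open import Algebra.Lattice.Bundles using (Lattice)
import Algebra.Lattice.Properties.Lattice as LatticeProperties
import Algebra.Properties.CommutativeSemigroup as CommutativeSemigroupProperties

module ALMonoidProperties {ℓ : Level} (A : ALMonoid ℓ) where
  open ALMonoid A

  lattice : Lattice ℓ ℓ
  lattice = record
    { Carrier   = Carrier
    ; _≈_       = _≡_
    ; _∨_       = _∨_
    ; _∧_       = _∧_
    ; isLattice = record
      { isEquivalence = isEquivalence
      ; ∨-comm        = ∨-comm
      ; ∨-assoc       = ∨-assoc
      ; ∨-cong        = cong₂ _∨_
      ; ∧-comm        = ∧-comm
      ; ∧-assoc       = ∧-assoc
      ; ∧-cong        = cong₂ _∧_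
      ; absorptive    = ∨-absorbs-∧ , ∧-absorbs-∨
      }
    }

  open LatticeProperties lattice using (∧-idem; ∨-idem)

  +-commutativeSemigroup : CommutativeSemigroup ℓ ℓ
  +-commutativeSemigroup = record
    { Carrier                = Carrier
    ; _≈_                    = _≡_
    ; _∙_                    = _+_
    ; isCommutativeSemigroup = record
      { isSemigroup = record
        { isMagma = record { isEquivalence = isEquivalence ; ∙-cong = cong₂ _+_ }
        ; assoc   = +-assoc
        }
      ; comm = +-comm
      }
    }

  open CommutativeSemigroupProperties +-commutativeSemigroup
    using (interchange; xy∙z≈y∙xz; x∙yz≈y∙xz)

  ≤-reflexive : ∀ {a b} → a ≡ b → a ≤ b
  ≤-reflexive {a} refl = ∨-idem a

  ≤-trans : ∀ {a b c} → a ≤ b → b ≤ c → a ≤ c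
  ≤-trans {a} {b} {c} a≤b b≤c = begin
    a ∨ c        ≡⟨ cong (a ∨_) b≤c ⟨
    a ∨ (b ∨ c)  ≡⟨ ∨-assoc a b c ⟨
    (a ∨ b) ∨ c  ≡⟨ cong (_∨ c) a≤b ⟩
    b ∨ c        ≡⟨ b≤c ⟩
    c            ∎
    where open ≡-Reasoning

  ≤-antisym : ∀ {a b} → a ≤ b → b ≤ a → a ≡ b
  ≤-antisym {a} {b} a≤b b≤a = trans (sym b≤a) (trans (∨-comm b a) a≤b)

  ≤-isPartialOrder : IsPartialOrder _≡_ _≤_
  ≤-isPartialOrder = record
    { isPreorder = record
      { isEquivalence = isEquivalence
      ; reflexive     = ≤-reflexive
      ; trans         = ≤-trans
      }
    ; antisym = ≤-antisym
    }

  ≤-poset : Poset ℓ ℓ ℓ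
  ≤-poset = record { isPartialOrder = ≤-isPartialOrder }

  module ≤-Reasoning = PosetReasoning ≤-poset

  ≤⇒∧≡ : ∀ {a b} → a ≤ b → a ∧ b ≡ a
  ≤⇒∧≡ {a} {b} a≤b = trans (cong (a ∧_) (sym a≤b)) (∧-absorbs-∨ a b)

  ∧≡⇒≤ : ∀ {a b} → a ∧ b ≡ a → a ≤ b
  ∧≡⇒≤ {a} {b} a∧b≡a = begin
    a ∨ b        ≡⟨ cong (_∨ b) a∧b≡a ⟨
    (a ∧ b) ∨ b  ≡⟨ ∨-comm (a ∧ b) b ⟩
    b ∨ (a ∧ b)  ≡⟨ cong (b ∨_) (∧-comm a b) ⟩
    b ∨ (b ∧ a)  ≡⟨ ∨-absorbs-∧ b a ⟩
    b            ∎
    where open ≡-Reasoning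

  ≤-isLattice : Order.IsLattice _≡_ _≤_ _∨_ _∧_
  ≤-isLattice = record
    { isPartialOrder = ≤-isPartialOrder
    ; supremum       = λ a b → a≤a∨b a b , b≤a∨b a b , λ c → ∨-least′ {a} {b} {c}
    ; infimum        = λ a b → a∧b≤a a b , a∧b≤b a b , λ c → ∧-greatest′ {a} {b} {c}
    }
    where
    open ≡-Reasoning

    a≤a∨b : ∀ a b → a ≤ a ∨ b
    a≤a∨b a b = trans (sym (∨-assoc a a b)) (cong (_∨ b) (∨-idem a))

    b≤a∨b : ∀ a b → b ≤ a ∨ b
    b≤a∨b a b = subst (b ≤_) (∨-comm b a) (a≤a∨b b a)

    ∨-least′ : ∀ {a b c} → a ≤ c → b ≤ c → a ∨ b ≤ c
    ∨-least′ {a} {b} {c} a≤c b≤c = trans (∨-assoc a b c) (trans (cong (a ∨_) b≤c) a≤c)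

    a∧b≤a : ∀ a b → a ∧ b ≤ a
    a∧b≤a a b = ∧≡⇒≤ (begin
      (a ∧ b) ∧ a  ≡⟨ ∧-assoc a b a ⟩
      a ∧ (b ∧ a)  ≡⟨ cong (a ∧_) (∧-comm b a) ⟩
      a ∧ (a ∧ b)  ≡⟨ ∧-assoc a a b ⟨
      (a ∧ a) ∧ b  ≡⟨ cong (_∧ b) (∧-idem a) ⟩
      a ∧ b        ∎)

    a∧b≤b : ∀ a b → a ∧ b ≤ b
    a∧b≤b a b = ∧≡⇒≤ (trans (∧-assoc a b b) (cong (a ∧_) (∧-idem b)))

    ∧-greatest′ : ∀ {a b c} → c ≤ a → c ≤ b → c ≤ a ∧ b
    ∧-greatest′ {a} {b} {c} c≤a c≤b =
      ∧≡⇒≤ (trans (sym (∧-assoc c a b)) (trans (cong (_∧ b) (≤⇒∧≡ c≤a)) (≤⇒∧≡ c≤b)))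

  ≤-lattice : Order.Lattice ℓ ℓ ℓ
  ≤-lattice = record { isLattice = ≤-isLattice }

  open Order.IsLattice ≤-isLattice using (x≤x∨y; y≤x∨y; ∨-least; x∧y≤x; x∧y≤y; ∧-greatest)
  open MeetSemilatticeProperties (Order.Lattice.meetSemilattice ≤-lattice) using (∧-monotonic)

  +-identityʳ : ∀ a → a + 0# ≡ a
  +-identityʳ a = trans (+-comm a 0#) (+-identityˡ a)

  +-distribʳ-∧ : ∀ a b c → (a ∧ b) + c ≡ (a + c) ∧ (b + c)
  +-distribʳ-∧ a b c = trans (+-comm (a ∧ b) c)
    (trans (+-distrib-∧ c a b) (cong₂ _∧_ (+-comm c a) (+-comm c b)))

  +-monoʳ-≤ : ∀ {a b} c → a ≤ b → c + a ≤ c + b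
  +-monoʳ-≤ {a} {b} c a≤b = trans (sym (+-distrib-∨ c a b)) (cong (c +_) a≤b)

  +-monoˡ-≤ : ∀ {a b} c → a ≤ b → a + c ≤ b + c
  +-monoˡ-≤ {a} {b} c a≤b = subst₂ _≤_ (+-comm c a) (+-comm c b) (+-monoʳ-≤ c a≤b)

  a≤a+b : ∀ a {b} → 0# ≤ b → a ≤ a + b
  a≤a+b a 0≤b = subst (_≤ a + _) (+-identityʳ a) (+-monoʳ-≤ a 0≤b)

  +-nonneg : ∀ {a b} → 0# ≤ a → 0# ≤ b → 0# ≤ a + b
  +-nonneg {a} 0≤a 0≤b = ≤-trans 0≤a (a≤a+b a 0≤b)

  ∧≡0#⇒+∧+≡ : ∀ {a b} c → a ∧ b ≡ 0# → (a + c) ∧ (b + c) ≡ c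
  ∧≡0#⇒+∧+≡ {a} {b} c a∧b≡0 =
    trans (sym (+-distribʳ-∧ a b c)) (trans (cong (_+ c) a∧b≡0) (+-identityˡ c))

  x*x≡0# : ∀ a → a * a ≡ 0#
  x*x≡0# a = Equivalence.from (*-zero⇔≡ a a) refl

  nonneg⇒x*0#≡x : ∀ {a} → 0# ≤ a → a * 0# ≡ a
  nonneg⇒x*0#≡x {a} 0≤a = begin
    a * 0#                ≡⟨ +-identityʳ (a * 0#) ⟨
    a * 0# + 0#           ≡⟨ cong (λ t → a * t + 0#) a∧0≡0 ⟨
    a * (a ∧ 0#) + 0#     ≡⟨ ax2 a 0# ⟩
    a ∨ 0#                ≡⟨ ∨-comm a 0# ⟩
    0# ∨ a                ≡⟨ 0≤a ⟩
    a                     ∎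
    where
    open ≡-Reasoning
    a∧0≡0 : a ∧ 0# ≡ 0#
    a∧0≡0 = trans (∧-comm a 0#) (≤⇒∧≡ 0≤a)

  infix 7 _⊝_
  _⊝_ : Carrier → Carrier → Carrier
  a ⊝ b = a * (a ∧ b)

  ⊝-nonneg : ∀ a b → 0# ≤ a ⊝ b
  ⊝-nonneg a b = *-nonneg a (a ∧ b)

  ⊝-∧ : ∀ a b → a ⊝ (a ∧ b) ≡ a ⊝ b
  ⊝-∧ a b = cong (a *_) (trans (sym (∧-assoc a a b)) (cong (_∧ b) (∧-idem a)))

  ⊝+∧≡ : ∀ a b → a ⊝ b + (a ∧ b) ≡ a
  ⊝+∧≡ a b = begin
    a ⊝ b + (a ∧ b)          ≡⟨ cong (_+ (a ∧ b)) (⊝-∧ a b) ⟨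
    a ⊝ (a ∧ b) + (a ∧ b)    ≡⟨ ax2 a (a ∧ b) ⟩
    a ∨ (a ∧ b)              ≡⟨ ∨-absorbs-∧ a b ⟩
    a                        ∎
    where open ≡-Reasoning

  ≤+⊝ : ∀ a b → a ≤ b + a ⊝ b
  ≤+⊝ a b = ≤-trans (x≤x∨y a b) (≤-reflexive (trans (sym (ax2 a b)) (+-comm (a ⊝ b) b)))

  +≡∨+∧ : ∀ a b → a + b ≡ (a ∨ b) + (a ∧ b)
  +≡∨+∧ a b = begin
    a + b                      ≡⟨ cong (_+ b) (⊝+∧≡ a b) ⟨
    (a ⊝ b + (a ∧ b)) + b      ≡⟨ +-assoc (a ⊝ b) (a ∧ b) b ⟩
    a ⊝ b + ((a ∧ b) + b)      ≡⟨ cong (a ⊝ b +_) (+-comm (a ∧ b) b) ⟩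
    a ⊝ b + (b + (a ∧ b))      ≡⟨ +-assoc (a ⊝ b) b (a ∧ b) ⟨
    (a ⊝ b + b) + (a ∧ b)      ≡⟨ cong (_+ (a ∧ b)) (ax2 a b) ⟩
    (a ∨ b) + (a ∧ b)          ∎
    where open ≡-Reasoning

  ∧≡0#⇒+≡∨ : ∀ {a b} → a ∧ b ≡ 0# → a + b ≡ a ∨ b
  ∧≡0#⇒+≡∨ {a} {b} a∧b≡0 =
    trans (+≡∨+∧ a b) (trans (cong ((a ∨ b) +_) a∧b≡0) (+-identityʳ (a ∨ b)))

  ⊝-least : ∀ {a b c} → 0# ≤ c → a ≤ b + c → a ⊝ b ≤ c
  ⊝-least {a} {b} {c} 0≤c a≤b+c = begin
    a * (a ∧ b)                ≡⟨ cong (λ t → t * (a ∧ b)) (≤⇒∧≡ a≤b+c) ⟨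
    (a ∧ (b + c)) * (a ∧ b)    ≤⟨ ∧-contr a (b + c) b ⟩
    (b + c) * b                ≡⟨ cong ((b + c) *_) (+-identityʳ b) ⟨
    (b + c) * (b + 0#)         ≤⟨ +-contr b c 0# ⟩
    c * 0#                     ≡⟨ nonneg⇒x*0#≡x 0≤c ⟩
    c                          ∎
    where open ≤-Reasoning

  ⊝-monoˡ-≤ : ∀ {a b} c → a ≤ b → a ⊝ c ≤ b ⊝ c
  ⊝-monoˡ-≤ {a} {b} c a≤b = ⊝-least (⊝-nonneg b c) (≤-trans a≤b (≤+⊝ b c))

  ⊝-monoʳ-≤ : ∀ a {b c} → b ≤ c → a ⊝ c ≤ a ⊝ b
  ⊝-monoʳ-≤ a {b} {c} b≤c = ⊝-least (⊝-nonneg a b) (≤-trans (≤+⊝ a b) (+-monoˡ-≤ (a ⊝ b) b≤c))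

  ⊝≤* : ∀ a b → a ⊝ b ≤ a * b
  ⊝≤* a b = subst (λ t → t * (a ∧ b) ≤ a * b) (∧-idem a) (∧-contr a a b)

  ⊝≡*∨ : ∀ a b → a ⊝ b ≡ b * (a ∨ b)
  ⊝≡*∨ a b = begin
    a ⊝ b
      ≡⟨ ≤-antisym (⊝-monoˡ-≤ b (x≤x∨y a b)) (⊝-least (⊝-nonneg a b) a∨b≤b+a⊝b) ⟩
    (a ∨ b) ⊝ b
      ≡⟨ cong ((a ∨ b) *_) (trans (∧-comm (a ∨ b) b) (≤⇒∧≡ (y≤x∨y a b))) ⟩
    (a ∨ b) * b
      ≡⟨ *-comm (a ∨ b) b ⟩
    b * (a ∨ b)
      ∎
    where
    open ≡-Reasoning
    a∨b≤b+a⊝b : a ∨ b ≤ b + a ⊝ b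
    a∨b≤b+a⊝b = ≤-reflexive (trans (sym (ax2 a b)) (+-comm (a ⊝ b) b))

  ⊝∧⊝≡0# : ∀ a b → (a ⊝ b) ∧ (b ⊝ a) ≡ 0#
  ⊝∧⊝≡0# a b = begin
    (a ⊝ b) ∧ (b ⊝ a)
      ≡⟨ cong₂ _∧_ (⊝≡*∨ a b) (trans (⊝≡*∨ b a) (cong (a *_) (∨-comm b a))) ⟩
    (b * (a ∨ b)) ∧ (a * (a ∨ b))
      ≡⟨ ∧-comm (b * (a ∨ b)) (a * (a ∨ b)) ⟩
    (a * (a ∨ b)) ∧ (b * (a ∨ b))
      ≡⟨ ax4 a b ⟩
    0#
      ∎
    where open ≡-Reasoning

  *≡⊝∨⊝ : ∀ a b → a * b ≡ (a ⊝ b) ∨ (b ⊝ a)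
  *≡⊝∨⊝ a b = ≤-antisym a*b≤⊝∨⊝ (∨-least (⊝≤* a b) (subst (b ⊝ a ≤_) (*-comm b a) (⊝≤* b a)))
    where
    open ≤-Reasoning
    a*b≤⊝∨⊝ : a * b ≤ (a ⊝ b) ∨ (b ⊝ a)
    a*b≤⊝∨⊝ = begin
      a * b
        ≤⟨ *-triangle a b (a ∧ b) ⟩
      a ⊝ b + (a ∧ b) * b
        ≡⟨ cong (a ⊝ b +_) (trans (*-comm (a ∧ b) b) (cong (b *_) (∧-comm a b))) ⟩
      a ⊝ b + b ⊝ a
        ≡⟨ ∧≡0#⇒+≡∨ (⊝∧⊝≡0# a b) ⟩
      (a ⊝ b) ∨ (b ⊝ a)
        ∎

  *≡⊝+⊝ : ∀ a b → a * b ≡ a ⊝ b + b ⊝ a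
  *≡⊝+⊝ a b = trans (*≡⊝∨⊝ a b) (sym (∧≡0#⇒+≡∨ (⊝∧⊝≡0# a b)))

  ⊝-distribʳ-∨ : ∀ a b c → (a ∨ b) ⊝ c ≡ (a ⊝ c) ∨ (b ⊝ c)
  ⊝-distribʳ-∨ a b c = ≤-antisym
    (⊝-least (≤-trans (⊝-nonneg a c) (x≤x∨y _ _))
      (∨-least (≤-trans (≤+⊝ a c) (+-monoʳ-≤ c (x≤x∨y _ _)))
               (≤-trans (≤+⊝ b c) (+-monoʳ-≤ c (y≤x∨y _ _)))))
    (∨-least (⊝-monoˡ-≤ c (x≤x∨y a b)) (⊝-monoˡ-≤ c (y≤x∨y a b)))

  ⊝-distribˡ-∧-∨ : ∀ a b c → a ⊝ (b ∧ c) ≡ (a ⊝ b) ∨ (a ⊝ c)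
  ⊝-distribˡ-∧-∨ a b c = ≤-antisym
    (⊝-least (≤-trans (⊝-nonneg a b) (x≤x∨y _ _))
      (subst (a ≤_) (sym (+-distribʳ-∧ b c _))
        (∧-greatest (≤-trans (≤+⊝ a b) (+-monoʳ-≤ b (x≤x∨y _ _)))
                    (≤-trans (≤+⊝ a c) (+-monoʳ-≤ c (y≤x∨y _ _))))))
    (∨-least (⊝-monoʳ-≤ a (x∧y≤x b c)) (⊝-monoʳ-≤ a (x∧y≤y b c)))

  ⊝≤⊝+∧⊝ : ∀ a b c → a ⊝ b ≤ a ⊝ c + (a ∧ c) ⊝ b
  ⊝≤⊝+∧⊝ a b c = ⊝-least (+-nonneg (⊝-nonneg a c) (⊝-nonneg (a ∧ c) b)) (begin
    a                                 ≡⟨ ⊝+∧≡ a c ⟨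
    a ⊝ c + (a ∧ c)                   ≤⟨ +-monoʳ-≤ (a ⊝ c) (≤+⊝ (a ∧ c) b) ⟩
    a ⊝ c + (b + (a ∧ c) ⊝ b)         ≡⟨ x∙yz≈y∙xz (a ⊝ c) b ((a ∧ c) ⊝ b) ⟩
    b + (a ⊝ c + (a ∧ c) ⊝ b)         ∎)
    where open ≤-Reasoning

  ⊝-distribʳ-∧ : ∀ a b c → (a ∧ b) ⊝ c ≡ (a ⊝ c) ∧ (b ⊝ c)
  ⊝-distribʳ-∧ a b c = ≤-antisym
    (∧-greatest (⊝-monoˡ-≤ c (x∧y≤x a b)) (⊝-monoˡ-≤ c (x∧y≤y a b)))
    (begin
      (a ⊝ c) ∧ (b ⊝ c)
        ≤⟨ ∧-monotonic (⊝≤⊝+∧⊝ a c b) (⊝≤⊝+∧⊝ b c a) ⟩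
      (a ⊝ b + (a ∧ b) ⊝ c) ∧ (b ⊝ a + (b ∧ a) ⊝ c)
        ≡⟨ cong (λ t → (a ⊝ b + (a ∧ b) ⊝ c) ∧ (b ⊝ a + t ⊝ c)) (∧-comm b a) ⟩
      (a ⊝ b + (a ∧ b) ⊝ c) ∧ (b ⊝ a + (a ∧ b) ⊝ c)
        ≡⟨ ∧≡0#⇒+∧+≡ ((a ∧ b) ⊝ c) (⊝∧⊝≡0# a b) ⟩
      (a ∧ b) ⊝ c
        ∎)
    where open ≤-Reasoning

  ⊝≤⊝+⊝∨ : ∀ a b c → a ⊝ b ≤ c ⊝ b + a ⊝ (b ∨ c)
  ⊝≤⊝+⊝∨ a b c = ⊝-least (+-nonneg (⊝-nonneg c b) (⊝-nonneg a (b ∨ c))) (begin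
    a                                 ≤⟨ ≤+⊝ a (b ∨ c) ⟩
    (b ∨ c) + a ⊝ (b ∨ c)             ≡⟨ cong (_+ a ⊝ (b ∨ c)) (trans (ax2 c b) (∨-comm c b)) ⟨
    (c ⊝ b + b) + a ⊝ (b ∨ c)         ≡⟨ xy∙z≈y∙xz (c ⊝ b) b (a ⊝ (b ∨ c)) ⟩
    b + (c ⊝ b + a ⊝ (b ∨ c))         ∎)
    where open ≤-Reasoning

  ⊝-distribˡ-∨-∧ : ∀ a b c → a ⊝ (b ∨ c) ≡ (a ⊝ b) ∧ (a ⊝ c)
  ⊝-distribˡ-∨-∧ a b c = ≤-antisym
    (∧-greatest (⊝-monoʳ-≤ a (x≤x∨y b c)) (⊝-monoʳ-≤ a (y≤x∨y b c)))
    (begin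
      (a ⊝ b) ∧ (a ⊝ c)
        ≤⟨ ∧-monotonic (⊝≤⊝+⊝∨ a b c) (⊝≤⊝+⊝∨ a c b) ⟩
      (c ⊝ b + a ⊝ (b ∨ c)) ∧ (b ⊝ c + a ⊝ (c ∨ b))
        ≡⟨ cong (λ t → (c ⊝ b + a ⊝ (b ∨ c)) ∧ (b ⊝ c + a ⊝ t)) (∨-comm c b) ⟩
      (c ⊝ b + a ⊝ (b ∨ c)) ∧ (b ⊝ c + a ⊝ (b ∨ c))
        ≡⟨ ∧≡0#⇒+∧+≡ (a ⊝ (b ∨ c)) (⊝∧⊝≡0# c b) ⟩
      a ⊝ (b ∨ c)
        ∎)
    where open ≤-Reasoning

  *≡∧*∨ : ∀ a c → a * c ≡ (a ∧ c) * (a ∨ c)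
  *≡∧*∨ a c = sym (begin
    (a ∧ c) * (a ∨ c)
      ≡⟨ *≡⊝∨⊝ (a ∧ c) (a ∨ c) ⟩
    ((a ∧ c) ⊝ (a ∨ c)) ∨ ((a ∨ c) ⊝ (a ∧ c))
      ≡⟨ cong (_∨ (a ∨ c) ⊝ (a ∧ c)) ∧⊝∨≡0# ⟩
    0# ∨ ((a ∨ c) ⊝ (a ∧ c))
      ≡⟨ ⊝-nonneg (a ∨ c) (a ∧ c) ⟩
    (a ∨ c) ⊝ (a ∧ c)
      ≡⟨ ⊝-distribʳ-∨ a c (a ∧ c) ⟩
    (a ⊝ (a ∧ c)) ∨ (c ⊝ (a ∧ c))
      ≡⟨ cong₂ _∨_ (⊝-∧ a c) (trans (cong (c ⊝_) (∧-comm a c)) (⊝-∧ c a)) ⟩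
    (a ⊝ c) ∨ (c ⊝ a)
      ≡⟨ *≡⊝∨⊝ a c ⟨
    a * c
      ∎)
    where
    open ≡-Reasoning
    ∧⊝∨≡0# : (a ∧ c) ⊝ (a ∨ c) ≡ 0#
    ∧⊝∨≡0# = trans (cong ((a ∧ c) *_) (≤⇒∧≡ (≤-trans (x∧y≤x a c) (x≤x∨y a c)))) (x*x≡0# (a ∧ c))

  *+*≡∧*+*∨ : ∀ a b c → a * b + b * c ≡ (a ∧ c) * b + b * (a ∨ c)
  *+*≡∧*+*∨ a b c = begin
    a * b + b * c
      ≡⟨ cong₂ _+_ (*≡⊝+⊝ a b) (trans (*-comm b c) (*≡⊝+⊝ c b)) ⟩
    (a ⊝ b + b ⊝ a) + (c ⊝ b + b ⊝ c)
      ≡⟨ interchange (a ⊝ b) (b ⊝ a) (c ⊝ b) (b ⊝ c) ⟩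
    (a ⊝ b + c ⊝ b) + (b ⊝ a + b ⊝ c)
      ≡⟨ cong₂ _+_ (trans (+≡∨+∧ (a ⊝ b) (c ⊝ b)) (+-comm ((a ⊝ b) ∨ (c ⊝ b)) ((a ⊝ b) ∧ (c ⊝ b))))
                   (+≡∨+∧ (b ⊝ a) (b ⊝ c)) ⟩
    (((a ⊝ b) ∧ (c ⊝ b)) + ((a ⊝ b) ∨ (c ⊝ b))) + (((b ⊝ a) ∨ (b ⊝ c)) + ((b ⊝ a) ∧ (b ⊝ c)))
      ≡⟨ cong₂ _+_ (cong₂ _+_ (⊝-distribʳ-∧ a c b) (⊝-distribʳ-∨ a c b))
                   (cong₂ _+_ (⊝-distribˡ-∧-∨ b a c) (⊝-distribˡ-∨-∧ b a c)) ⟨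
    ((a ∧ c) ⊝ b + (a ∨ c) ⊝ b) + (b ⊝ (a ∧ c) + b ⊝ (a ∨ c))
      ≡⟨ interchange ((a ∧ c) ⊝ b) ((a ∨ c) ⊝ b) (b ⊝ (a ∧ c)) (b ⊝ (a ∨ c)) ⟩
    ((a ∧ c) ⊝ b + b ⊝ (a ∧ c)) + ((a ∨ c) ⊝ b + b ⊝ (a ∨ c))
      ≡⟨ cong₂ _+_ (*≡⊝+⊝ (a ∧ c) b) (trans (*-comm b (a ∨ c)) (*≡⊝+⊝ (a ∨ c) b)) ⟨
    (a ∧ c) * b + b * (a ∨ c)
      ∎
    where open ≡-Reasoning

mainTheorem9 : ∀ {ℓ : Level} (A : ALMonoid ℓ) → let open ALMonoid A in
    ∀ a b c → (Between a b c ⇔ Between (a ∧ c) b (a ∨ c))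
mainTheorem9 A a b c = mk⇔
  (λ between → trans (sym (*+*≡∧*+*∨ a b c)) (trans between (*≡∧*∨ a c)))
  (λ between → trans (*+*≡∧*+*∨ a b c) (trans between (sym (*≡∧*∨ a c))))
  where open ALMonoidProperties A
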